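{- Let $A,B$ be downsets. If $\pi$ is $A$-minimal and $\sigma$ is $B$-minimal, then $\pi \oplus \sigma$ is $A \oplus B$-minimal, and $\pi \ominus \sigma$ is $A \ominus B$-minimal.
   Context: A permutation of length $n\ge0$ is a bijection $\pi$ of $[n]$, written as $\pi(1)\ldots\pi(n)$. $\pi$ contains $\tau$ ($\tau$ is a pattern of $\pi$) if $\pi$ has a subsequence in the same relative order as $\tau$; it is a proper pattern if $\tau$ is shorter than $\pi$. $\mathbb N=\{0,1,2,\dots\}$. For $r,s\in\mathbb N$, $\pi$ is $(r,s)$-coverable if its terms can be partitioned into $r$ increasing and $s$ decreasing (possibly empty) subsequences. $D(\pi)=\{(r,s)\in\mathbb N^2:\pi\text{ is not }(r,s)\text{ -coverable}\}$. A downset is a finite subset $A\subseteq\mathbb N^2$ such that $(r,s)\in A$, $r'\le r$, $s'\le s$ imply $(r',s')\in A$. For a downset $A$, $\pi$ is $A$-coverable if $\pi$ is $(r,s)$-coverable for some $(r,s)\in A$; $\pi$ is $A$-critical if $\pi$ is not $A$-coverable but every proper pattern of $\pi$ is $A$-coverable; $\pi$ is $A$-minimal if it is $A$-critical and $D(\pi)=A$. For permutations $\pi$ of length $n$ and $\sigma$ of length $m$: $\pi\oplus\sigma=\pi(1)\ldots\pi(n),\ \sigma(1)+n\ldots\sigma(m)+n$ and $\pi\ominus\sigma=\pi(1)+m\ldots\pi(n)+m,\ \sigma(1)\ldots\sigma(m)$. For downsets $A,B$: $A\oplus B$ is the set of $(r,s)$ such that for all $s_1+s_2=s$ ($s_i\in\mathbb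 N$), $(r,s_1)\in A$ or $(r,s_2)\in B$; $A\ominus B$ is the set of $(r,s)$ such that for all $r_1+r_2=r$ ($r_i\in\mathbb N$), $(r_1,s)\in A$ or $(r_2,s)\in B$. -}

module Defs where

open import Data.Nat as ℕ using (ℕ; _+_)
open import Data.Nat.Properties using (+-comm)
open import Data.Fin as Fin using (Fin; splitAt; _↑ˡ_; _↑ʳ_; cast)
open import Data.Sum using (_⊎_; inj₁; inj₂)
open import Data.Product using (Σ; ∃; _×_; _,_)
open import Data.Empty using (⊥)
open import Relation.Nullary using (¬_)
open import Relation.Binary.PropositionalEquality using (_≡_)
open import Function.Definitions using (Injective)
open import Function.Bundles using (_⇔_)

-- A "word" of length n: π(1)…π(n), values in Fin n (0-based).
Perm : ℕ → Set
Perm n = Fin n → Fin n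

-- π is a permutation (a bijection of [n]); injective suffices on Fin n.
IsPerm : ∀ {n} → Perm n → Set
IsPerm π = Injective _≡_ _≡_ π

Contains : ∀ {n k} → Perm n → Perm k → Set
Contains {n} {k} π τ =
  Σ (Fin k → Fin n) λ e →
    (∀ i j → i Fin.< j → e i Fin.< e j) ×
    (∀ i j → (τ i Fin.< τ j) ⇔ (π (e i) Fin.< π (e j)))

ProperPattern : ∀ {n k} → Perm n → Perm k → Set
ProperPattern {n} {k} π τ = IsPerm τ × k ℕ.< n × Contains π τ

Coverable : ∀ {n} → Perm n → ℕ → ℕ → Set
Coverable {n} π r s =
  Σ (Fin n → Fin r ⊎ Fin s) λ c →
    (∀ i j (a : Fin r) → c i ≡ inj₁ a → c j ≡ inj₁ a → i Fin.< j → π i Fin.< π j) ×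
    (∀ i j (b : Fin s) → c i ≡ inj₂ b → c j ≡ inj₂ b → i Fin.< j → π j Fin.< π i)

Set² : Set₁
Set² = ℕ → ℕ → Set

D : ∀ {n} → Perm n → Set²
D π r s = ¬ Coverable π r s

IsDownset : Set² → Set
IsDownset A =
  (∃ λ N → ∀ r s → A r s → r ℕ.< N × s ℕ.< N) ×
  (∀ r s r′ s′ → A r s → r′ ℕ.≤ r → s′ ℕ.≤ s → A r′ s′)

ACoverable : Set² → ∀ {n} → Perm n → Set
ACoverable A π = Σ ℕ λ r → Σ ℕ λ s → A r s × Coverable π r s

ACritical : Set² → ∀ {n} → Perm n → Set
ACritical A π =
  ¬ ACoverable A π ×
  (∀ {k} (τ : Perm k) → ProperPattern π τ → ACoverable A τ)

AMinimal : Set² → ∀ {n} → Perm n → Set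
AMinimal A π = ACritical A π × (∀ r s → D π r s ⇔ A r s)

_⊕ᵖ_ : ∀ {n m} → Perm n → Perm m → Perm (n + m)
_⊕ᵖ_ {n} {m} π σ i with splitAt n i
... | inj₁ a = π a ↑ˡ m
... | inj₂ b = n ↑ʳ σ b

_⊖ᵖ_ : ∀ {n m} → Perm n → Perm m → Perm (n + m)
_⊖ᵖ_ {n} {m} π σ i with splitAt n i
... | inj₁ a = cast (+-comm m n) (m ↑ʳ π a)
... | inj₂ b = cast (+-comm m n) (σ b ↑ˡ n)

_⊕ˢ_ : Set² → Set² → Set²
(A ⊕ˢ B) r s = ∀ s₁ s₂ → s₁ + s₂ ≡ s → A r s₁ ⊎ B r s₂

_⊖ˢ_ : Set² → Set² → Set²
(A ⊖ˢ B) r s = ∀ r₁ r₂ → r₁ + r₂ ≡ r → A r₁ s ⊎ B r₂ s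

-- In a cover of π ⊕ σ an increasing class may run through both summands, but a decreasing
-- class cannot, since every point of σ lies to the right of and above every point of π. Hence
-- covers of the summands glue along their increasing classes, and a cover of the sum splits by
-- sorting its decreasing classes: D(π ⊕ σ) = D(π) ⊕ D(σ). For criticality it suffices that
-- π ⊕ σ minus any point is (A ⊕ B)-coverable. If the point lies in π, criticality of π covers
-- the rest of π with some (r, s) ∈ A; take t least with (r, t) ∉ B, so that σ is
-- (r, t)-coverable, and the glued cover uses (r, s + t) ∈ A ⊕ B. Finally, complementing
-- values exchanges ⊕ with ⊖ and increasing with decreasing classes, so the ⊖ case is the
-- ⊕ case for the transposed downsets.

module Submission where

open import Defs
open import Data.Fin.Base as Fin
  using (Fin; toℕ; splitAt; join; _↑ˡ_; _↑ʳ_; punchIn; punchOut; opposite; cast)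
import Data.Fin.Properties as Finₚ
open import Data.Nat.Base as ℕ using (ℕ; zero; suc; _+_; _∸_)
import Data.Nat.Properties as ℕₚ
open import Data.Product.Base as Product using (Σ; ∃; ∃₂; _×_; _,_; proj₁; proj₂)
open import Data.Sum.Base as Sum using (_⊎_; inj₁; inj₂)
import Data.Sum.Properties as Sumₚ
open import Data.Sum.Relation.Binary.LeftOrder using (_⊎-<_; ₁∼₂; ₁∼₁; ₂∼₂; drop-inj₁; drop-inj₂)
open import Data.Unit.Base using (⊤; tt)
open import Data.Vec.Functional using (_∷_; head; tail)
open import Function.Base using (_∘_)
open import Function.Definitions using (Injective)
open import Function.Bundles using (_⇔_; mk⇔; Equivalence)
import Function.Properties.Equivalence as ⇔
open import Relation.Binary.PropositionalEquality
  using (_≡_; _≢_; _≗_; refl; sym; trans; cong; cong₂; subst₂; module ≡-Reasoning)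
open import Relation.Nullary using (¬_; Dec; yes; no; contradiction)
open import Relation.Nullary.Decidable as Dec using (_⊎-dec_; _×-dec_; _→-dec_; ¬?; decidable-stable)
open import Relation.Unary using (Decidable)

private
  variable
    n m k r s t : ℕ
    I J J₁ J₂ : Set
    π : Perm n
    σ : Perm m
    τ : Perm k
    A B : Set²

-- Only the points satisfying P are coloured: a total colouring would need a junk colour, and
-- Fin r ⊎ Fin s may be empty.
PartialColouring : {n : ℕ} → (Fin n → Set) → Set → Set → Set
PartialColouring {n} P I J = (i : Fin n) → P i → I ⊎ J

Monotone : {P : Fin n → Set} → Perm n → PartialColouring P I J → Set
Monotone π c =
  (∀ i j pᵢ pⱼ a → c i pᵢ ≡ inj₁ a → c j pⱼ ≡ inj₁ a → i Fin.< j → π i Fin.< π j) ×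
  (∀ i j pᵢ pⱼ b → c i pᵢ ≡ inj₂ b → c j pⱼ ≡ inj₂ b → i Fin.< j → π j Fin.< π i)

CoverOn : (Fin n → Set) → Perm n → Set → Set → Set
CoverOn P π I J = Σ (PartialColouring P I J) (Monotone π)

coverOn : Coverable π r s → CoverOn (λ _ → ⊤) π (Fin r) (Fin s)
coverOn (c , inc , dec) = (λ i _ → c i) , (λ i j _ _ → inc i j) , (λ i j _ _ → dec i j)

coverable : {P : Fin n → Set} → CoverOn P π (Fin r) (Fin s) → (∀ i → P i) → Coverable π r s
coverable (c , inc , dec) p =
  (λ i → c i (p i)) , (λ i j → inc i j (p i) (p j)) , (λ i j → dec i j (p i) (p j))

restrict : {P Q : Fin n → Set} → (∀ {i} → Q i → P i) → CoverOn P π I J → CoverOn Q π I J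
restrict Q⇒P (c , inc , dec) =
  (λ i → c i ∘ Q⇒P) ,
  (λ i j qᵢ qⱼ → inc i j (Q⇒P qᵢ) (Q⇒P qⱼ)) , (λ i j qᵢ qⱼ → dec i j (Q⇒P qᵢ) (Q⇒P qⱼ))

coverOn-pattern : {P : Fin n → Set} (C : Contains π τ) →
                  CoverOn P π I J → CoverOn (P ∘ proj₁ C) τ I J
coverOn-pattern (e , e-mono , e-iso) (c , inc , dec) =
  (λ i → c (e i)) ,
  (λ i j pᵢ pⱼ a cᵢ cⱼ i<j →
     Equivalence.from (e-iso i j) (inc (e i) (e j) pᵢ pⱼ a cᵢ cⱼ (e-mono i j i<j))) ,
  (λ i j pᵢ pⱼ b cᵢ cⱼ i<j →
     Equivalence.from (e-iso j i) (dec (e i) (e j) pᵢ pⱼ b cᵢ cⱼ (e-mono i j i<j)))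

InjectionOn : {J : Set} → (J → Set) → Set → Set
InjectionOn {J} U J′ =
  Σ ((b : J) → U b → J′) λ g → ∀ {b b′ u u′} → g b u ≡ g b′ u′ → b ≡ b′

recolour : {P : Fin n → Set} {I J J′ : Set} {U : J → Set} (X : CoverOn P π I J) → InjectionOn U J′ →
           (∀ i p b → proj₁ X i p ≡ inj₂ b → U b) → CoverOn P π I J′
recolour {π = π} {I = I} {J} {J′} {U} (c , inc , dec) (g , g-injective) used =
  (λ i p → rename (c i p) (used i p)) ,
  (λ i j pᵢ pⱼ a eᵢ eⱼ → inc i j pᵢ pⱼ a (rename-inj₁ eᵢ) (rename-inj₁ eⱼ)) ,
  (λ i j pᵢ pⱼ b eᵢ eⱼ → decreasing (rename-inj₂ eᵢ) (rename-inj₂ eⱼ))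
  where
  rename : (x : I ⊎ J) → (∀ b → x ≡ inj₂ b → U b) → I ⊎ J′
  rename (inj₁ a) _ = inj₁ a
  rename (inj₂ b) u = inj₂ (g b (u b refl))
  rename-inj₁ : ∀ {x u a} → rename x u ≡ inj₁ a → x ≡ inj₁ a
  rename-inj₁ {inj₁ _} refl = refl
  rename-inj₂ : ∀ {x u b′} → rename x u ≡ inj₂ b′ → ∃₂ λ b w → x ≡ inj₂ b × g b w ≡ b′
  rename-inj₂ {inj₂ b} refl = b , _ , refl , refl
  decreasing : ∀ {i j pᵢ pⱼ b′} → (∃₂ λ b w → c i pᵢ ≡ inj₂ b × g b w ≡ b′) →
               (∃₂ λ b w → c j pⱼ ≡ inj₂ b × g b w ≡ b′) → i Fin.< j → π j Fin.< π i
  decreasing {i} {j} {pᵢ} {pⱼ} (b , _ , eᵢ , gᵢ) (_ , _ , eⱼ , gⱼ) =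
    dec i j pᵢ pⱼ b eᵢ (trans eⱼ (cong inj₂ (g-injective (trans gⱼ (sym gᵢ)))))

_<⊎_ : Fin n ⊎ Fin m → Fin n ⊎ Fin m → Set
_<⊎_ = Fin._<_ ⊎-< Fin._<_

join-mono-< : {x y : Fin n ⊎ Fin m} → x <⊎ y → join n m x Fin.< join n m y
join-mono-< {n} {m} (₁∼₂ {a} {b}) =
  subst₂ ℕ._<_ (sym (Finₚ.toℕ-↑ˡ a m)) (sym (Finₚ.toℕ-↑ʳ n b))
    (ℕₚ.<-≤-trans (Finₚ.toℕ<n a) (ℕₚ.m≤m+n n (toℕ b)))
join-mono-< {m = m} (₁∼₁ {a} {a′} a<a′) =
  subst₂ ℕ._<_ (sym (Finₚ.toℕ-↑ˡ a m)) (sym (Finₚ.toℕ-↑ˡ a′ m)) a<a′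
join-mono-< {n} (₂∼₂ {b} {b′} b<b′) =
  subst₂ ℕ._<_ (sym (Finₚ.toℕ-↑ʳ n b)) (sym (Finₚ.toℕ-↑ʳ n b′)) (ℕₚ.+-monoʳ-< n b<b′)

join-cancel-< : (x y : Fin n ⊎ Fin m) → join n m x Fin.< join n m y → x <⊎ y
join-cancel-< {m = m} (inj₁ a) (inj₁ a′) h =
  ₁∼₁ (subst₂ ℕ._<_ (Finₚ.toℕ-↑ˡ a m) (Finₚ.toℕ-↑ˡ a′ m) h)
join-cancel-< (inj₁ _) (inj₂ _) _ = ₁∼₂
join-cancel-< {n} {m} (inj₂ b) (inj₁ a) h =
  contradiction (ℕₚ.<-trans (subst₂ ℕ._<_ (Finₚ.toℕ-↑ʳ n b) (Finₚ.toℕ-↑ˡ a m) h) (Finₚ.toℕ<n a))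
                (ℕₚ.m+n≮m n (toℕ b))
join-cancel-< {n} (inj₂ b) (inj₂ b′) h =
  ₂∼₂ (ℕₚ.+-cancelˡ-< n (toℕ b) (toℕ b′) (subst₂ ℕ._<_ (Finₚ.toℕ-↑ʳ n b) (Finₚ.toℕ-↑ʳ n b′) h))

splitAt-injective : (i j : Fin (n + m)) → splitAt n i ≡ splitAt n j → i ≡ j
splitAt-injective {n} {m} i j eq =
  trans (sym (Finₚ.join-splitAt n m i)) (trans (cong (join n m) eq) (Finₚ.join-splitAt n m j))

splitAt-mono-< : {i j : Fin (n + m)} → i Fin.< j → splitAt n i <⊎ splitAt n j
splitAt-mono-< {n} {m} {i} {j} i<j =
  join-cancel-< _ _ (subst₂ Fin._<_ (sym (Finₚ.join-splitAt n m i)) (sym (Finₚ.join-splitAt n m j)) i<j)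

⊕-view : (π : Perm n) (σ : Perm m) (i : Fin (n + m)) →
         (π ⊕ᵖ σ) i ≡ join n m (Sum.map π σ (splitAt n i))
⊕-view {n} π σ i with splitAt n i
... | inj₁ _ = refl
... | inj₂ _ = refl

⊕-join : (π : Perm n) (σ : Perm m) (x : Fin n ⊎ Fin m) →
         (π ⊕ᵖ σ) (join n m x) ≡ join n m (Sum.map π σ x)
⊕-join {n} {m} π σ x =
  trans (⊕-view π σ (join n m x)) (cong (join n m ∘ Sum.map π σ) (Finₚ.splitAt-join n m x))

⊕-mono-< : (π : Perm n) (σ : Perm m) {i j : Fin (n + m)} →
           Sum.map π σ (splitAt n i) <⊎ Sum.map π σ (splitAt n j) → (π ⊕ᵖ σ) i Fin.< (π ⊕ᵖ σ) j
⊕-mono-< π σ {i} {j} h = subst₂ Fin._<_ (sym (⊕-view π σ i)) (sym (⊕-view π σ j)) (join-mono-< h)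

⊕-join-< : (π : Perm n) (σ : Perm m) (x y : Fin n ⊎ Fin m) →
           Sum.map π σ x <⊎ Sum.map π σ y ⇔ (π ⊕ᵖ σ) (join n m x) Fin.< (π ⊕ᵖ σ) (join n m y)
⊕-join-< π σ x y =
  mk⇔ (subst₂ Fin._<_ (sym (⊕-join π σ x)) (sym (⊕-join π σ y)) ∘ join-mono-<)
      (join-cancel-< _ _ ∘ subst₂ Fin._<_ (⊕-join π σ x) (⊕-join π σ y))

⊕-containsˡ : (π : Perm n) (σ : Perm m) → Contains (π ⊕ᵖ σ) π
⊕-containsˡ π σ =
  (join _ _ ∘ inj₁) , (λ _ _ → join-mono-< ∘ ₁∼₁) ,
  λ a a′ → ⇔.trans (mk⇔ ₁∼₁ drop-inj₁) (⊕-join-< π σ (inj₁ a) (inj₁ a′))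

⊕-containsʳ : (π : Perm n) (σ : Perm m) → Contains (π ⊕ᵖ σ) σ
⊕-containsʳ π σ =
  (join _ _ ∘ inj₂) , (λ _ _ → join-mono-< ∘ ₂∼₂) ,
  λ b b′ → ⇔.trans (mk⇔ ₂∼₂ drop-inj₂) (⊕-join-< π σ (inj₂ b) (inj₂ b′))

private
  map₂-inj₁ : {X Y Z : Set} {f : Y → Z} {x : X ⊎ Y} {a : X} → Sum.map₂ f x ≡ inj₁ a → x ≡ inj₁ a
  map₂-inj₁ {x = inj₁ _} refl = refl

  map₂-inj₂ : {X Y Z : Set} {f : Y → Z} {x : X ⊎ Y} {c : Z} → Sum.map₂ f x ≡ inj₂ c →
              ∃ λ b → x ≡ inj₂ b × f b ≡ c
  map₂-inj₂ {x = inj₂ b} refl = b , refl , refl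

cover-⊕ : {n m : ℕ} {π : Perm n} {σ : Perm m} {I J₁ J₂ : Set} {R : Fin n ⊎ Fin m → Set} →
          CoverOn (R ∘ inj₁) π I J₁ → CoverOn (R ∘ inj₂) σ I J₂ →
          CoverOn (R ∘ splitAt n) (π ⊕ᵖ σ) I (J₁ ⊎ J₂)
cover-⊕ {n} {m} {π} {σ} {I} {J₁} {J₂} {R} (c₁ , inc₁ , dec₁) (c₂ , inc₂ , dec₂) =
  (λ i → colour (splitAt n i)) ,
  (λ i j pᵢ pⱼ a eᵢ eⱼ i<j → ⊕-mono-< π σ (increasing _ _ pᵢ pⱼ eᵢ eⱼ (splitAt-mono-< i<j))) ,
  (λ i j pᵢ pⱼ b eᵢ eⱼ i<j → ⊕-mono-< π σ (decreasing _ _ pᵢ pⱼ eᵢ eⱼ (splitAt-mono-< i<j)))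
  where
  colour : (x : Fin n ⊎ Fin m) → R x → I ⊎ (J₁ ⊎ J₂)
  colour (inj₁ a) p = Sum.map₂ inj₁ (c₁ a p)
  colour (inj₂ b) p = Sum.map₂ inj₂ (c₂ b p)

  increasing : ∀ x y pₓ p_y {a} → colour x pₓ ≡ inj₁ a → colour y p_y ≡ inj₁ a →
               x <⊎ y → Sum.map π σ x <⊎ Sum.map π σ y
  increasing (inj₁ a) (inj₁ a′) p p′ e e′ (₁∼₁ a<a′) =
    ₁∼₁ (inc₁ a a′ p p′ _ (map₂-inj₁ e) (map₂-inj₁ e′) a<a′)
  increasing (inj₁ _) (inj₂ _) _ _ _ _ ₁∼₂ = ₁∼₂
  increasing (inj₂ b) (inj₂ b′) p p′ e e′ (₂∼₂ b<b′) =
    ₂∼₂ (inc₂ b b′ p p′ _ (map₂-inj₁ e) (map₂-inj₁ e′) b<b′)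

  decreasing : ∀ x y pₓ p_y {c} → colour x pₓ ≡ inj₂ c → colour y p_y ≡ inj₂ c →
               x <⊎ y → Sum.map π σ y <⊎ Sum.map π σ x
  decreasing (inj₁ a) (inj₁ a′) p p′ e e′ (₁∼₁ a<a′)
    with b , eb , fb ← map₂-inj₂ e | _ , eb′ , fb′ ← map₂-inj₂ e′ =
    ₁∼₁ (dec₁ a a′ p p′ b eb (trans eb′ (cong inj₂ (Sumₚ.inj₁-injective (trans fb′ (sym fb))))) a<a′)
  decreasing (inj₁ a) (inj₂ b) p p′ e e′ ₁∼₂
    with _ , _ , fb ← map₂-inj₂ {x = c₁ a p} e | _ , _ , fb′ ← map₂-inj₂ {x = c₂ b p′} e′ =
    contradiction (trans fb (sym fb′)) λ ()
  decreasing (inj₂ b) (inj₂ b′) p p′ e e′ (₂∼₂ b<b′)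
    with d , ed , fd ← map₂-inj₂ e | _ , ed′ , fd′ ← map₂-inj₂ e′ =
    ₂∼₂ (dec₂ b b′ p p′ d ed (trans ed′ (cong inj₂ (Sumₚ.inj₂-injective (trans fd′ (sym fd))))) b<b′)

join-injection : InjectionOn {J = Fin s ⊎ Fin t} (λ _ → ⊤) (Fin (s + t))
join-injection {s} {t} =
  (λ b _ → join s t b) ,
  λ {b} {b′} eq →
    trans (sym (Finₚ.splitAt-join s t b)) (trans (cong (splitAt s) eq) (Finₚ.splitAt-join s t b′))

join-colours : {P : Fin n → Set} → CoverOn P π I (Fin s ⊎ Fin t) → CoverOn P π I (Fin (s + t))
join-colours X = recolour X join-injection λ _ _ _ _ → tt

coverable-⊕ : Coverable π r s → Coverable σ r t → Coverable (π ⊕ᵖ σ) r (s + t)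
coverable-⊕ cπ cσ =
  coverable (join-colours (cover-⊕ {R = λ _ → ⊤} (coverOn cπ) (coverOn cσ))) (λ _ → tt)

private
  extend-new : {U : Fin (suc s) → Set} →
               InjectionOn (U ∘ Fin.suc) (Fin t) → U Fin.zero → InjectionOn U (Fin (suc t))
  extend-new {s} {t} {U} (g , g-injective) _ = g′ , g′-injective
    where
    g′ : (b : Fin (suc s)) → U b → Fin (suc t)
    g′ Fin.zero    _ = Fin.zero
    g′ (Fin.suc b) u = Fin.suc (g b u)
    g′-injective : ∀ {b b′ u u′} → g′ b u ≡ g′ b′ u′ → b ≡ b′
    g′-injective {Fin.zero}  {Fin.zero}  _  = refl
    g′-injective {Fin.suc _} {Fin.suc _} eq = cong Fin.suc (g-injective (Finₚ.suc-injective eq))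

  extend-absent : {U : Fin (suc s) → Set} →
                  InjectionOn (U ∘ Fin.suc) (Fin t) → ¬ U Fin.zero → InjectionOn U (Fin t)
  extend-absent {s} {t} {U} (g , g-injective) ¬u₀ = g′ , g′-injective
    where
    g′ : (b : Fin (suc s)) → U b → Fin t
    g′ Fin.zero    u = contradiction u ¬u₀
    g′ (Fin.suc b) u = g b u
    g′-injective : ∀ {b b′ u u′} → g′ b u ≡ g′ b′ u′ → b ≡ b′
    g′-injective {Fin.zero}  {u = u}            _  = contradiction u ¬u₀
    g′-injective {Fin.suc _} {Fin.zero} {u′ = u′} _ = contradiction u′ ¬u₀
    g′-injective {Fin.suc _} {Fin.suc _}        eq = cong Fin.suc (g-injective eq)

partition : (U : Fin s → Set) → Decidable U →
            ∃₂ λ s₁ s₂ → s₁ + s₂ ≡ s × InjectionOn U (Fin s₁) × InjectionOn (¬_ ∘ U) (Fin s₂)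
partition {zero} U U? = 0 , 0 , refl , ((λ ()) , λ { {()} }) , ((λ ()) , λ { {()} })
partition {suc s} U U? with partition (U ∘ Fin.suc) (U? ∘ Fin.suc) | U? Fin.zero
... | s₁ , s₂ , eq , g₁ , g₂ | yes u₀ =
  suc s₁ , s₂ , cong suc eq , extend-new g₁ u₀ , extend-absent g₂ (λ ¬u₀ → ¬u₀ u₀)
... | s₁ , s₂ , eq , g₁ , g₂ | no ¬u₀ =
  s₁ , suc s₂ , trans (ℕₚ.+-suc s₁ s₂) (cong suc eq) , extend-absent g₁ ¬u₀ , extend-new g₂ ¬u₀

coverable-⊕-split : Coverable (π ⊕ᵖ σ) r s →
               ∃₂ λ s₁ s₂ → s₁ + s₂ ≡ s × Coverable π r s₁ × Coverable σ r s₂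
coverable-⊕-split {π = π} {σ = σ} {r = r} {s = s} cover = split (partition Usedπ usedπ?)
  where
  X = coverOn cover
  Xπ = coverOn-pattern (⊕-containsˡ π σ) X
  Xσ = coverOn-pattern (⊕-containsʳ π σ) X

  Usedπ : Fin s → Set
  Usedπ b = ∃ λ a → proj₁ Xπ a tt ≡ inj₂ b

  usedπ? : Decidable Usedπ
  usedπ? b = Finₚ.any? λ a → Sumₚ.≡-dec Finₚ._≟_ Finₚ._≟_ (proj₁ Xπ a tt) (inj₂ b)

  unusedσ : ∀ q _ b → proj₁ Xσ q tt ≡ inj₂ b → ¬ Usedπ b
  unusedσ q _ b eq (a , ea) with () ←
    Equivalence.from (⊕-join-< π σ (inj₂ q) (inj₁ a))
      (proj₂ (proj₂ X) (join _ _ (inj₁ a)) (join _ _ (inj₂ q)) tt tt b ea eq (join-mono-< ₁∼₂))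

  split : (∃₂ λ s₁ s₂ → s₁ + s₂ ≡ s × InjectionOn Usedπ (Fin s₁) × InjectionOn (¬_ ∘ Usedπ) (Fin s₂)) →
          ∃₂ λ s₁ s₂ → s₁ + s₂ ≡ s × Coverable π r s₁ × Coverable σ r s₂
  split (s₁ , s₂ , eq , gπ , gσ) =
    s₁ , s₂ , eq ,
    coverable (recolour Xπ gπ λ a _ _ e → a , e) (λ _ → tt) ,
    coverable (recolour Xσ gσ unusedσ) (λ _ → tt)

IsCover : Perm n → (Fin n → I ⊎ J) → Set
IsCover π c =
  (∀ i j a → c i ≡ inj₁ a → c j ≡ inj₁ a → i Fin.< j → π i Fin.< π j) ×
  (∀ i j b → c i ≡ inj₂ b → c j ≡ inj₂ b → i Fin.< j → π j Fin.< π i)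

IsCover-resp : {c c′ : Fin n → I ⊎ J} → c ≗ c′ → IsCover π c → IsCover π c′
IsCover-resp c≗c′ (inc , dec) =
  (λ i j a eᵢ eⱼ → inc i j a (trans (c≗c′ i) eᵢ) (trans (c≗c′ j) eⱼ)) ,
  (λ i j b eᵢ eⱼ → dec i j b (trans (c≗c′ i) eᵢ) (trans (c≗c′ j) eⱼ))

Searchable : Set → Set₁
Searchable X = ∀ {P : X → Set} → Decidable P → Dec (∃ P)

searchable-⊎ : {X Y : Set} → Searchable X → Searchable Y → Searchable (X ⊎ Y)
searchable-⊎ search₁ search₂ P? =
  Dec.map′ (λ { (inj₁ (x , p)) → inj₁ x , p ; (inj₂ (y , p)) → inj₂ y , p })
           (λ { (inj₁ x , p) → inj₁ (x , p) ; (inj₂ y , p) → inj₂ (y , p) })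
           (search₁ (P? ∘ inj₁) ⊎-dec search₂ (P? ∘ inj₂))

search-functions : {X : Set} → Searchable X → {P : (Fin n → X) → Set} →
                   (∀ {f g} → f ≗ g → P f → P g) → Decidable P → Dec (∃ P)
search-functions {n = zero} {X} _ resp P? =
  Dec.map′ (empty ,_) (λ (f , p) → resp (λ ()) p) (P? empty)
  where
  empty : Fin 0 → X
  empty ()
search-functions {n = suc n} search resp P? =
  Dec.map′ (λ (x , f , p) → x ∷ f , p) (λ (f , p) → head f , tail f , resp η p)
           (search λ x → search-functions search (resp ∘ ∷-cong x) (P? ∘ (x ∷_)))
  where
  η : ∀ {f} → f ≗ head f ∷ tail f
  η Fin.zero    = refl
  η (Fin.suc i) = refl
  ∷-cong : ∀ x {f g} → f ≗ g → x ∷ f ≗ x ∷ g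
  ∷-cong x f≗g Fin.zero    = refl
  ∷-cong x f≗g (Fin.suc i) = f≗g i

isCover? : (π : Perm n) (c : Fin n → Fin r ⊎ Fin s) → Dec (IsCover π c)
isCover? π c =
  Finₚ.all? (λ i → Finₚ.all? λ j → Finₚ.all? λ a →
    (c i ≟ inj₁ a) →-dec (c j ≟ inj₁ a) →-dec (i Finₚ.<? j) →-dec (π i Finₚ.<? π j))
  ×-dec
  Finₚ.all? (λ i → Finₚ.all? λ j → Finₚ.all? λ b →
    (c i ≟ inj₂ b) →-dec (c j ≟ inj₂ b) →-dec (i Finₚ.<? j) →-dec (π j Finₚ.<? π i))
  where _≟_ = Sumₚ.≡-dec Finₚ._≟_ Finₚ._≟_

coverable? : (π : Perm n) (r s : ℕ) → Dec (Coverable π r s)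
coverable? π r s = search-functions (searchable-⊎ Finₚ.any? Finₚ.any?) IsCover-resp (isCover? π)

coverable-stable : ¬ D π r s → Coverable π r s
coverable-stable {π = π} {r} {s} = decidable-stable (coverable? π r s)

D-⊕ : (π : Perm n) (σ : Perm m) → ∀ r s → D (π ⊕ᵖ σ) r s ⇔ (D π ⊕ˢ D σ) r s
D-⊕ π σ r s = mk⇔ to from
  where
  to : D (π ⊕ᵖ σ) r s → (D π ⊕ˢ D σ) r s
  to ¬cover s₁ s₂ refl with coverable? π r s₁ | coverable? σ r s₂
  ... | no ¬cπ | _      = inj₁ ¬cπ
  ... | yes _  | no ¬cσ = inj₂ ¬cσ
  ... | yes cπ | yes cσ = contradiction (coverable-⊕ cπ cσ) ¬cover
  from : (D π ⊕ˢ D σ) r s → D (π ⊕ᵖ σ) r s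
  from D⊕D cover with coverable-⊕-split cover
  ... | s₁ , s₂ , eq , cπ , cσ = Sum.[ (λ ¬cπ → ¬cπ cπ) , (λ ¬cσ → ¬cσ cσ) ]′ (D⊕D s₁ s₂ eq)

⊕ˢ-cong : {A′ B′ : Set²} → (∀ r s → A r s ⇔ A′ r s) → (∀ r s → B r s ⇔ B′ r s) →
          ∀ r s → (A ⊕ˢ B) r s ⇔ (A′ ⊕ˢ B′) r s
⊕ˢ-cong A⇔A′ B⇔B′ r s =
  mk⇔ (λ h s₁ s₂ eq → Sum.map (Equivalence.to (A⇔A′ r s₁)) (Equivalence.to (B⇔B′ r s₂)) (h s₁ s₂ eq))
      (λ h s₁ s₂ eq → Sum.map (Equivalence.from (A⇔A′ r s₁)) (Equivalence.from (B⇔B′ r s₂)) (h s₁ s₂ eq))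

misses-point : k ℕ.< n → (e : Fin k → Fin n) → ∃ λ x → ∀ i → e i ≢ x
misses-point {k} {n} k<n e with Finₚ.all? (λ x → Finₚ.any? λ i → e i Finₚ.≟ x)
... | yes onto = contradiction (Finₚ.injective⇒≤ preimage-injective) (ℕₚ.<⇒≱ k<n)
  where
  preimage-injective : Injective _≡_ _≡_ (proj₁ ∘ onto)
  preimage-injective {x} {y} eq = trans (sym (proj₂ (onto x))) (trans (cong e eq) (proj₂ (onto y)))
... | no ¬onto with x , ¬hit ← Finₚ.¬∀⟶∃¬ n _ (λ x → Finₚ.any? λ i → e i Finₚ.≟ x) ¬onto =
  x , λ i eᵢ≡x → ¬hit (i , eᵢ≡x)

LeastCounterexample : (ℕ → Set) → Set
LeastCounterexample P = ∃ λ t → ¬ P t × (∀ {k} → k ℕ.< t → P k)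

private
  scan : {P : ℕ → Set} → Decidable P → ∀ N → (∀ {k} → k ℕ.< N → P k) ⊎ LeastCounterexample P
  scan P? zero = inj₁ λ ()
  scan P? (suc N) with scan P? N
  ... | inj₂ least = inj₂ least
  ... | inj₁ below with P? N
  ...   | no ¬PN = inj₂ (N , ¬PN , below)
  ...   | yes PN = inj₁ λ k<1+N → Sum.[ below , (λ { refl → PN }) ]′ (ℕₚ.m<1+n⇒m<n∨m≡n k<1+N)

least-counterexample : {P : ℕ → Set} → Decidable P → ¬ P n → LeastCounterexample P
least-counterexample {n} P? ¬Pn with scan P? (suc n)
... | inj₁ below = contradiction (below ℕₚ.≤-refl) ¬Pn
... | inj₂ least = least

punchIn-mono-< : (p : Fin (suc n)) {i j : Fin n} → i Fin.< j → punchIn p i Fin.< punchIn p j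
punchIn-mono-< p {i} {j} i<j =
  ℕₚ.≤∧≢⇒< (Finₚ.punchIn-mono-≤ p i j (ℕₚ.<⇒≤ i<j))
           (Finₚ.<⇒≢ i<j ∘ Finₚ.punchIn-injective p i j ∘ Finₚ.toℕ-injective)

punchOut-mono-< : {p i j : Fin (suc n)} (p≢i : p ≢ i) (p≢j : p ≢ j) →
                  i Fin.< j → punchOut p≢i Fin.< punchOut p≢j
punchOut-mono-< p≢i p≢j i<j = ℕₚ.≰⇒> (ℕₚ.<⇒≱ i<j ∘ Finₚ.punchOut-cancel-≤ p≢j p≢i)

punchOut-cancel-< : {p i j : Fin (suc n)} (p≢i : p ≢ i) (p≢j : p ≢ j) →
                    punchOut p≢i Fin.< punchOut p≢j → i Fin.< j
punchOut-cancel-< p≢i p≢j h = ℕₚ.≰⇒> (ℕₚ.<⇒≱ h ∘ Finₚ.punchOut-mono-≤ p≢j p≢i)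

private
  pivot≢ : (π : Perm (suc n)) → IsPerm π → ∀ p i → π p ≢ π (punchIn p i)
  pivot≢ π π-injective p i = Finₚ.punchInᵢ≢i p i ∘ sym ∘ π-injective

delete : (π : Perm (suc n)) → IsPerm π → Fin (suc n) → Perm n
delete π π-injective p i = punchOut (pivot≢ π π-injective p i)

delete-contains : (π : Perm (suc n)) (π-injective : IsPerm π) (p : Fin (suc n)) →
                  Contains π (delete π π-injective p)
delete-contains π π-injective p =
  punchIn p , (λ _ _ → punchIn-mono-< p) ,
  λ i j → mk⇔ (punchOut-cancel-< (≢ᵢ i) (≢ᵢ j)) (punchOut-mono-< (≢ᵢ i) (≢ᵢ j))
  where ≢ᵢ = pivot≢ π π-injective p

delete-proper : (π : Perm (suc n)) (π-injective : IsPerm π) (p : Fin (suc n)) →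
                ProperPattern π (delete π π-injective p)
delete-proper π π-injective p =
  (λ {i} {j} → Finₚ.punchIn-injective p i j ∘ π-injective ∘ Finₚ.punchOut-injective (≢ᵢ i) (≢ᵢ j)) ,
  ℕₚ.≤-refl , delete-contains π π-injective p
  where ≢ᵢ = pivot≢ π π-injective p

coverOn-delete : (π : Perm (suc n)) (π-injective : IsPerm π) (p : Fin (suc n)) →
                 Coverable (delete π π-injective p) r s → CoverOn (_≢ p) π (Fin r) (Fin s)
coverOn-delete {n} π π-injective p (c , inc , dec) =
  (λ a a≢p → c (out a≢p)) ,
  (λ a b a≢p b≢p k eₐ e_b a<b →
     lift a≢p b≢p (inc (out a≢p) (out b≢p) k eₐ e_b (punchOut-mono-< (a≢p ∘ sym) (b≢p ∘ sym) a<b))) ,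
  (λ a b a≢p b≢p k eₐ e_b a<b →
     lift b≢p a≢p (dec (out a≢p) (out b≢p) k eₐ e_b (punchOut-mono-< (a≢p ∘ sym) (b≢p ∘ sym) a<b)))
  where
  out : ∀ {a} → a ≢ p → Fin n
  out a≢p = punchOut (a≢p ∘ sym)
  lift : ∀ {a b} (a≢p : a ≢ p) (b≢p : b ≢ p) →
         delete π π-injective p (out a≢p) Fin.< delete π π-injective p (out b≢p) → π a Fin.< π b
  lift a≢p b≢p =
    subst₂ (λ x y → π x Fin.< π y)
           (Finₚ.punchIn-punchOut (a≢p ∘ sym)) (Finₚ.punchIn-punchOut (b≢p ∘ sym))
    ∘ punchOut-cancel-< (pivot≢ π π-injective p (out a≢p)) (pivot≢ π π-injective p (out b≢p))

PatternsCoverable : Set² → Perm n → Set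
PatternsCoverable A π = ∀ {k} (τ : Perm k) → ProperPattern π τ → ACoverable A τ

DeletionCoverable : Set² → Perm n → Set
DeletionCoverable {n} A π = (x : Fin n) → ∃₂ λ r s → A r s × CoverOn (_≢ x) π (Fin r) (Fin s)

patterns⇒deletions : IsPerm π → PatternsCoverable A π → DeletionCoverable A π
patterns⇒deletions {zero} _ _ ()
patterns⇒deletions {suc n} {π} π-injective patterns p with patterns _ (delete-proper π π-injective p)
... | r , s , Ars , cover = r , s , Ars , coverOn-delete π π-injective p cover

deletions⇒patterns : DeletionCoverable A π → PatternsCoverable A π
deletions⇒patterns deletions τ (_ , k<n , C) with misses-point k<n (proj₁ C)
... | x , e≢x with deletions x
...   | r , s , Ars , X = r , s , Ars , coverable (coverOn-pattern C X) e≢x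

least-cover : IsDownset B → (∀ r s → D σ r s ⇔ B r s) →
              ∀ r → ∃ λ t → Coverable σ r t × (∀ {k} → k ℕ.< t → B r k)
least-cover {σ = σ} ((N , bounded) , _) D⇔B r
  with least-counterexample (λ k → ¬? (coverable? σ r k))
         (ℕₚ.<-irrefl refl ∘ proj₂ ∘ bounded r N ∘ Equivalence.to (D⇔B r N))
... | t , ¬Dt , below = t , coverable-stable ¬Dt , Equivalence.to (D⇔B r _) ∘ below

private
  split-sum : ∀ {s₁ s₂ s t} → s₁ + s₂ ≡ s + t → s₁ ℕ.≤ s ⊎ s₂ ℕ.< t
  split-sum {s₁} {s₂} {s} {t} eq with s₁ ℕₚ.≤? s
  ... | yes s₁≤s = inj₁ s₁≤s
  ... | no s₁≰s = inj₂ (ℕₚ.≰⇒> λ t≤s₂ → ℕₚ.<-irrefl (sym eq) (ℕₚ.+-mono-<-≤ (ℕₚ.≰⇒> s₁≰s) t≤s₂))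

⊕ˢ-memberˡ : IsDownset A → A r s → (∀ {k} → k ℕ.< t → B r k) → (A ⊕ˢ B) r (s + t)
⊕ˢ-memberˡ {A = A} {B = B} (_ , closed) Ars below s₁ s₂ eq =
  Sum.map {C = A _ s₁} {D = B _ s₂} (closed _ _ _ _ Ars ℕₚ.≤-refl) below (split-sum eq)

⊕ˢ-memberʳ : IsDownset B → B r t → (∀ {k} → k ℕ.< s → A r k) → (A ⊕ˢ B) r (s + t)
⊕ˢ-memberʳ {B = B} {t = t} {s = s} {A = A} (_ , closed) Brt below s₁ s₂ eq =
  Sum.swap (Sum.map {C = B _ s₂} {D = A _ s₁} (closed _ _ _ _ Brt ℕₚ.≤-refl) below
                    (split-sum (trans (ℕₚ.+-comm s₂ s₁) (trans eq (ℕₚ.+-comm s t)))))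

cover-⊕-except : {n m : ℕ} {π : Perm n} {σ : Perm m} (x : Fin (n + m)) →
                 CoverOn (λ a → inj₁ a ≢ splitAt n x) π I J₁ →
                 CoverOn (λ b → inj₂ b ≢ splitAt n x) σ I J₂ →
                 CoverOn (_≢ x) (π ⊕ᵖ σ) I (J₁ ⊎ J₂)
cover-⊕-except {n = n} x Xπ Xσ =
  restrict (λ {y} y≢x → y≢x ∘ splitAt-injective y x) (cover-⊕ {R = _≢ splitAt n x} Xπ Xσ)

deletions-⊕ : {n m : ℕ} {π : Perm n} {σ : Perm m} → IsDownset A → IsDownset B →
              (∀ r s → D π r s ⇔ A r s) → (∀ r s → D σ r s ⇔ B r s) →
              DeletionCoverable A π → DeletionCoverable B σ → DeletionCoverable (A ⊕ˢ B) (π ⊕ᵖ σ)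
deletions-⊕ {A = A} {B = B} {n = n} dA dB D⇔A D⇔B deletionsπ deletionsσ x with splitAt n x in x-split
... | inj₁ p with deletionsπ p
...   | r , s , Ars , Xπ with least-cover dB D⇔B r
...     | t , cσ , below =
  r , s + t , ⊕ˢ-memberˡ {B = B} dA Ars below ,
  join-colours (cover-⊕-except x (restrict (λ ne a≡p → ne (trans (cong inj₁ a≡p) (sym x-split))) Xπ)
                               (restrict _ (coverOn cσ)))
deletions-⊕ {A = A} {B = B} {n = n} dA dB D⇔A D⇔B deletionsπ deletionsσ x | inj₂ q with deletionsσ q
...   | r , t , Brt , Xσ with least-cover dA D⇔A r
...     | s , cπ , below =
  r , s + t , ⊕ˢ-memberʳ {A = A} dB Brt below ,
  join-colours (cover-⊕-except x (restrict _ (coverOn cπ))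
                               (restrict (λ ne b≡q → ne (trans (cong inj₂ b≡q) (sym x-split))) Xσ))

aminimal : PatternsCoverable A π → (∀ r s → D π r s ⇔ A r s) → AMinimal A π
aminimal patterns D⇔A =
  ((λ (r , s , Ars , cover) → Equivalence.from (D⇔A r s) Ars cover) , patterns) , D⇔A

AMinimal-⊕ : IsDownset A → IsDownset B → IsPerm π → IsPerm σ →
             AMinimal A π → AMinimal B σ → AMinimal (A ⊕ˢ B) (π ⊕ᵖ σ)
AMinimal-⊕ {π = π} {σ = σ} dA dB π-injective σ-injective
           ((_ , patternsπ) , D⇔A) ((_ , patternsσ) , D⇔B) =
  aminimal (deletions⇒patterns (deletions-⊕ dA dB D⇔A D⇔B deletionsπ deletionsσ))
           (λ r s → ⇔.trans (D-⊕ π σ r s) (⊕ˢ-cong D⇔A D⇔B r s))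
  where
  deletionsπ = patterns⇒deletions π-injective patternsπ
  deletionsσ = patterns⇒deletions σ-injective patternsσ

complement : Perm n → Perm n
complement π = opposite ∘ π

opposite-mono-< : {i j : Fin n} → i Fin.< j → opposite j Fin.< opposite i
opposite-mono-< {n} {i} {j} i<j =
  subst₂ ℕ._<_ (sym (Finₚ.opposite-prop j)) (sym (Finₚ.opposite-prop i))
    (ℕₚ.∸-monoʳ-< (ℕ.s<s i<j) (Finₚ.toℕ<n j))

opposite-<⇔ : {i j : Fin n} → i Fin.< j ⇔ opposite j Fin.< opposite i
opposite-<⇔ {i = i} {j} =
  mk⇔ opposite-mono-<
      (subst₂ Fin._<_ (Finₚ.opposite-involutive i) (Finₚ.opposite-involutive j) ∘ opposite-mono-<)

complement-involutive : (π : Perm n) → complement (complement π) ≗ π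
complement-involutive π = Finₚ.opposite-involutive ∘ π

complement-injective : IsPerm π → IsPerm (complement π)
complement-injective {π = π} π-injective {i} {j} eq =
  π-injective (trans (sym (complement-involutive π i))
                     (trans (cong opposite eq) (complement-involutive π j)))

coverable-resp : {π′ : Perm n} → π ≗ π′ → Coverable π r s → Coverable π′ r s
coverable-resp π≗π′ (c , inc , dec) =
  c , (λ i j a eᵢ eⱼ → subst₂ Fin._<_ (π≗π′ i) (π≗π′ j) ∘ inc i j a eᵢ eⱼ) ,
      (λ i j b eᵢ eⱼ → subst₂ Fin._<_ (π≗π′ j) (π≗π′ i) ∘ dec i j b eᵢ eⱼ)

contains-resp : {π′ : Perm n} → π ≗ π′ → Contains π τ → Contains π′ τ
contains-resp {τ = τ} π≗π′ (e , e-mono , e-iso) =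
  e , e-mono , λ i j → subst₂ (λ x y → τ i Fin.< τ j ⇔ x Fin.< y) (π≗π′ (e i)) (π≗π′ (e j)) (e-iso i j)

coverable-complement : Coverable π r s → Coverable (complement π) s r
coverable-complement (c , inc , dec) =
  Sum.swap ∘ c ,
  (λ i j a eᵢ eⱼ → opposite-mono-< ∘ dec i j a (unswap eᵢ) (unswap eⱼ)) ,
  (λ i j b eᵢ eⱼ → opposite-mono-< ∘ inc i j b (unswap eᵢ) (unswap eⱼ))
  where
  unswap : ∀ {x : Fin _ ⊎ Fin _} {y} → Sum.swap x ≡ y → x ≡ Sum.swap y
  unswap {x} e = trans (sym (Sumₚ.swap-involutive x)) (cong Sum.swap e)

contains-complement : Contains π τ → Contains (complement π) (complement τ)
contains-complement (e , e-mono , e-iso) =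
  e , e-mono , λ i j → ⇔.trans (⇔.sym opposite-<⇔) (⇔.trans (e-iso j i) opposite-<⇔)

proper-complement : ProperPattern (complement π) τ → ProperPattern π (complement τ)
proper-complement {π = π} (τ-injective , k<n , C) =
  complement-injective τ-injective , k<n ,
  contains-resp (complement-involutive π) (contains-complement {π = complement π} C)

D-complement : (π : Perm n) → ∀ r s → D (complement π) r s ⇔ D π s r
D-complement π r s =
  mk⇔ (λ ¬c → ¬c ∘ coverable-complement)
      (λ ¬c → ¬c ∘ coverable-resp (complement-involutive π) ∘ coverable-complement)

_ᵀ : Set² → Set²
(A ᵀ) r s = A s r

IsDownset-ᵀ : IsDownset A → IsDownset (A ᵀ)
IsDownset-ᵀ ((N , bounded) , closed) =
  (N , λ r s a → Product.swap (bounded s r a)) ,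
  λ r s r′ s′ a r′≤r s′≤s → closed s r s′ r′ a s′≤s r′≤r

AMinimal-complement : AMinimal A π → AMinimal (A ᵀ) (complement π)
AMinimal-complement {π = π} ((_ , patterns) , D⇔A) =
  aminimal patterns′ (λ r s → ⇔.trans (D-complement π r s) (D⇔A s r))
  where
  patterns′ : PatternsCoverable (_ ᵀ) (complement π)
  patterns′ τ proper with patterns (complement τ) (proper-complement {π = π} proper)
  ... | r , s , Ars , cover =
    s , r , Ars , coverable-resp (complement-involutive τ) (coverable-complement cover)

AMinimal-resp : {π′ : Perm n} → π ≗ π′ → AMinimal A π → AMinimal A π′
AMinimal-resp {π = π} {π′ = π′} π≗π′ ((_ , patterns) , D⇔A) =
  aminimal (λ τ (τ-injective , k<n , C) → patterns τ (τ-injective , k<n , contains-resp (sym ∘ π≗π′) C))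
           (λ r s → ⇔.trans (D-resp r s) (D⇔A r s))
  where
  D-resp : ∀ r s → D π′ r s ⇔ D π r s
  D-resp r s = mk⇔ (λ ¬c → ¬c ∘ coverable-resp π≗π′) (λ ¬c → ¬c ∘ coverable-resp (sym ∘ π≗π′))

complement-⊖ : (π : Perm n) (σ : Perm m) → complement (π ⊖ᵖ σ) ≗ complement π ⊕ᵖ complement σ
complement-⊖ {n} {m} π σ i with splitAt n i
... | inj₁ a = Finₚ.toℕ-injective (begin
  toℕ (opposite (cast _ (m ↑ʳ π a)))    ≡⟨ Finₚ.opposite-prop _ ⟩
  n + m ∸ suc (toℕ (cast _ (m ↑ʳ π a))) ≡⟨ cong (λ v → n + m ∸ suc v)
                                             (trans (Finₚ.toℕ-cast _ _) (Finₚ.toℕ-↑ʳ m (π a))) ⟩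
  n + m ∸ suc (m + toℕ (π a))           ≡⟨ cong₂ _∸_ (ℕₚ.+-comm n m) (sym (ℕₚ.+-suc m (toℕ (π a)))) ⟩
  m + n ∸ (m + suc (toℕ (π a)))         ≡⟨ ℕₚ.[m+n]∸[m+o]≡n∸o m n (suc (toℕ (π a))) ⟩
  n ∸ suc (toℕ (π a))                   ≡⟨ Finₚ.opposite-prop (π a) ⟨
  toℕ (opposite (π a))                  ≡⟨ Finₚ.toℕ-↑ˡ (opposite (π a)) m ⟨
  toℕ (opposite (π a) ↑ˡ m)             ∎)
  where open ≡-Reasoning
... | inj₂ b = Finₚ.toℕ-injective (begin
  toℕ (opposite (cast _ (σ b ↑ˡ n)))    ≡⟨ Finₚ.opposite-prop _ ⟩
  n + m ∸ suc (toℕ (cast _ (σ b ↑ˡ n))) ≡⟨ cong (λ v → n + m ∸ suc v)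
                                             (trans (Finₚ.toℕ-cast _ _) (Finₚ.toℕ-↑ˡ (σ b) n)) ⟩
  n + m ∸ suc (toℕ (σ b))               ≡⟨ ℕₚ.+-∸-assoc n (Finₚ.toℕ<n (σ b)) ⟩
  n + (m ∸ suc (toℕ (σ b)))             ≡⟨ cong (n +_) (Finₚ.opposite-prop (σ b)) ⟨
  n + toℕ (opposite (σ b))              ≡⟨ Finₚ.toℕ-↑ʳ n (opposite (σ b)) ⟨
  toℕ (n ↑ʳ opposite (σ b))             ∎)
  where open ≡-Reasoning

AMinimal-⊖ : IsDownset A → IsDownset B → IsPerm π → IsPerm σ →
             AMinimal A π → AMinimal B σ → AMinimal (A ⊖ˢ B) (π ⊖ᵖ σ)
AMinimal-⊖ {π = π} {σ = σ} dA dB π-injective σ-injective minA minB =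
  AMinimal-resp (complement-involutive (π ⊖ᵖ σ))
    (AMinimal-complement
      (AMinimal-resp (sym ∘ complement-⊖ π σ)
        (AMinimal-⊕ (IsDownset-ᵀ dA) (IsDownset-ᵀ dB)
                    (complement-injective π-injective) (complement-injective σ-injective)
                    (AMinimal-complement minA) (AMinimal-complement minB))))

lemma5 : (A B : Set²) → IsDownset A → IsDownset B →
           ∀ {n m} (π : Perm n) (σ : Perm m) → IsPerm π → IsPerm σ →
           AMinimal A π → AMinimal B σ →
           AMinimal (A ⊕ˢ B) (π ⊕ᵖ σ) × AMinimal (A ⊖ˢ B) (π ⊖ᵖ σ)
lemma5 A B dA dB π σ π-injective σ-injective minA minB =
  AMinimal-⊕ dA dB π-injective σ-injective minA minB ,
  AMinimal-⊖ dA dB π-injective σ-injective minA minB
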